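{- Let $(\mathcal{L}(P),\vdash)$ be a disjunctive sequent calculus. If $S$ is a logical state, then the family $\{[\Gamma]_S:\Gamma \text{ a finite subset of } S\}$ is directed under inclusion and $S$ is its union, where $[\Gamma]_S=\bigcap\{W\in|(\mathcal{L}(P),\vdash)|:\Gamma\subseteq W\subseteq S\}$.
   Context: A disjunctive basis is $(P,\mathcal{A}_P)$ with $P$ a set of atomic formulae and $\mathcal{A}_P$ a set of sequents $p_1,\dots,p_n\vdash\mathrm{F}$, $p_i\in P$. Formulae $\mathcal{L}(P)$ and valid sequents $\Gamma\vdash\varphi$ ($\Gamma$ finite) are generated by simultaneous transfinite induction: atoms, $\mathrm{T}$, $\mathrm{F}$ are formulae; $\phi\wedge\psi$; $\dot{\bigvee}_{i\in I}\phi_i$ whenever $\phi_i,\phi_j\vdash\mathrm{F}$ valid for all $i\ne j$. Valid sequents: members of $\mathcal{A}_P$; $\phi\vdash\phi$; $\Gamma\vdash\psi\Rightarrow\Gamma,\phi\vdash\psi$; $\Gamma\vdash\phi,\ \Delta,\phi\vdash\psi\Rightarrow\Gamma,\Delta\vdash\psi$; $\mathrm{F}\vdash\phi$; $\vdash\mathrm{T}$; $\Gamma,\phi,\psi\vdash\theta\Rightarrow\Gamma,\phi\wedge\psi\vdash\theta$; $\Gamma\vdash\phi,\ \Delta\vdash\psi\Rightarrow\Gamma,\Delta\vdash\phi\wedge\psi$; for families with $\phi_i,\phi_j\vdash\mathrm{F}$ ($i\neq j$): ($\Gamma,\phi_i\vdash\theta$ for all $i$) $\Rightarrow\Gamma,\dot{\bigvee}_i\phi_i\vdash\theta$,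 and $\Gamma\vdash\phi_{i_0}\Rightarrow\Gamma\vdash\dot{\bigvee}_i\phi_i$. $X[\vdash]=\{\varphi:\Gamma\vdash\varphi\text{ valid for some finite }\Gamma\subseteq X\}$. Tautology: $\mathrm{T}\vdash\varphi$; contradiction: $\varphi\vdash\mathrm{F}$; satisfiable: neither. Conjunction: satisfiable formula built from atoms by $\wedge$ only. Flat formula: satisfiable $\dot{\bigvee}_i\mu_i$, $\mu_i$ conjunctions, $\mu_i,\mu_j\vdash\mathrm{F}$ for $i\ne j$. A logical state is a nonempty proper subset $S\subseteq\mathcal{L}(P)$ with (S1) a flat formula $\dot{\bigvee}_i\mu_i\in S$ implies $\mu_{i_0}\in S$ for some $i_0$; (S2) $S[\vdash]\subseteq S$. $|(\mathcal{L}(P),\vdash)|$ is the set of logical states. -}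

module Defs where

open import Level using (Level; 0ℓ) renaming (suc to lsuc)
open import Data.List using (List; []; _∷_; _++_; map)
open import Data.List.Relation.Unary.All using (All)
open import Data.Product using (Σ; ∃; _×_; _,_)
open import Data.Empty using (⊥)
open import Relation.Nullary using (¬_)
open import Relation.Binary.PropositionalEquality using (_≡_; _≢_)

-- A disjunctive basis: atoms P and axioms Ax (each axiom is a finite list
-- of atoms p₁,…,pₙ standing for the sequent p₁,…,pₙ ⊢ F).
module _ {P : Set} (Ax : List P → Set) where

  infixr 6 _∧_
  infix 4 _⊢_

  data Form : Set₁
  data _⊢_ : List Form → Form → Set₁

  data Form where
    atom : P → Form
    T F  : Form
    _∧_  : Form → Form → Form
    -- disjoint disjunction over an arbitrary index set I; the side
    -- condition (pairwise contradiction) is proof-irrelevant, so a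
    -- formula is determined by its syntax only.
    ⋁    : (I : Set) (φ : I → Form) →
           .(∀ i j → i ≢ j → φ i ∷ φ j ∷ [] ⊢ F) → Form

  data _⊢_ where
    ax     : ∀ {ps} → Ax ps → map atom ps ⊢ F
    idn    : ∀ {φ} → φ ∷ [] ⊢ φ
    -- contexts are finite sets: exchange and contraction (with `weak`
    -- this makes validity depend only on the underlying set of Γ)
    exch   : ∀ {Γ Δ φ ψ θ} → Γ ++ φ ∷ ψ ∷ Δ ⊢ θ → Γ ++ ψ ∷ φ ∷ Δ ⊢ θ
    contr  : ∀ {Γ φ θ} → φ ∷ φ ∷ Γ ⊢ θ → φ ∷ Γ ⊢ θ
    weak   : ∀ {Γ φ ψ} → Γ ⊢ ψ → φ ∷ Γ ⊢ ψ
    cut    : ∀ {Γ Δ φ ψ} → Γ ⊢ φ → φ ∷ Δ ⊢ ψ → Γ ++ Δ ⊢ ψ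
    F⊢     : ∀ {φ} → F ∷ [] ⊢ φ
    ⊢T     : [] ⊢ T
    ∧L     : ∀ {Γ φ ψ θ} → φ ∷ ψ ∷ Γ ⊢ θ → φ ∧ ψ ∷ Γ ⊢ θ
    ∧R     : ∀ {Γ Δ φ ψ} → Γ ⊢ φ → Δ ⊢ ψ → Γ ++ Δ ⊢ φ ∧ ψ
    ⋁L     : ∀ {Γ θ} (I : Set) (φ : I → Form)
             (d : ∀ i j → i ≢ j → φ i ∷ φ j ∷ [] ⊢ F) →
             (∀ i → φ i ∷ Γ ⊢ θ) → ⋁ I φ d ∷ Γ ⊢ θ
    ⋁R     : ∀ {Γ} (I : Set) (φ : I → Form)
             (d : ∀ i j → i ≢ j → φ i ∷ φ j ∷ [] ⊢ F) (i₀ : I) →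
             Γ ⊢ φ i₀ → Γ ⊢ ⋁ I φ d

  Subset : Set₂
  Subset = Form → Set₁

  _⊆_ : ∀ {a b} → (Form → Set a) → (Form → Set b) → Set (lsuc 0ℓ Level.⊔ a Level.⊔ b)
  A ⊆ B = ∀ φ → A φ → B φ

  _⊆ₗ_ : ∀ {a} → List Form → (Form → Set a) → Set (lsuc 0ℓ Level.⊔ a)
  Γ ⊆ₗ S = All S Γ

  Tautology Contradiction Satisfiable : Form → Set₁
  Tautology φ = T ∷ [] ⊢ φ
  Contradiction φ = φ ∷ [] ⊢ F
  Satisfiable φ = ¬ Tautology φ × ¬ Contradiction φ

  data ConjShape : Form → Set₁ where
    atomᶜ : ∀ p → ConjShape (atom p)
    _∧ᶜ_  : ∀ {φ ψ} → ConjShape φ → ConjShape ψ → ConjShape (φ ∧ ψ)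

  Conjunction : Form → Set₁
  Conjunction φ = ConjShape φ × Satisfiable φ

  Closure : Subset → Subset
  Closure S φ = Σ (List Form) λ Γ → Γ ⊆ₗ S × Γ ⊢ φ

  record IsState (S : Subset) : Set₂ where
    field
      nonempty : ∃ λ φ → S φ
      proper   : ∃ λ φ → ¬ S φ
      S1 : ∀ (I : Set) (μ : I → Form)
             (d : ∀ i j → i ≢ j → μ i ∷ μ j ∷ [] ⊢ F) →
             (∀ i → Conjunction (μ i)) → Satisfiable (⋁ I μ d) →
             S (⋁ I μ d) → ∃ λ i₀ → S (μ i₀)
      S2 : Closure S ⊆ S

  ⟦_⟧[_] : List Form → Subset → Form → Set₂
  ⟦ Γ ⟧[ S ] φ = ∀ (W : Subset) → IsState W → Γ ⊆ₗ W → W ⊆ S → W φ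

-- [Γ]_S shrinks as Γ grows, so [Γ₁ ∪ Γ₂]_S is an upper bound of [Γ₁]_S and [Γ₂]_S.
-- Every φ ∈ S lies in [{φ}]_S, and conversely [Γ]_S ⊆ S because S is itself one
-- of the states being intersected.
module Submission where

open import Defs
open import Data.List using (List; []; _∷_; _++_)
open import Data.List.Relation.Unary.All using ([]; _∷_; head)
open import Data.List.Relation.Unary.All.Properties using (++⁺; ++⁻ˡ; ++⁻ʳ)
open import Data.Product using (Σ; _×_; _,_)
open import Function.Bundles using (_⇔_; mk⇔)

module _ {P : Set} (Ax : List P → Set) where

  ⟦⟧-antitone : ∀ {Γ Δ : List (Form Ax)} (S : Subset Ax) →
    (∀ {W : Subset Ax} → _⊆ₗ_ Ax Δ W → _⊆ₗ_ Ax Γ W) →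
    _⊆_ Ax (⟦_⟧[_] Ax Γ S) (⟦_⟧[_] Ax Δ S)
  ⟦⟧-antitone S Γ⊆Δ φ φ∈⟦Γ⟧ W W-state Δ⊆W W⊆S = φ∈⟦Γ⟧ W W-state (Γ⊆Δ Δ⊆W) W⊆S

  ⟦⟧-directed : ∀ (S : Subset Ax) (Γ₁ Γ₂ : List (Form Ax)) →
    _⊆_ Ax (⟦_⟧[_] Ax Γ₁ S) (⟦_⟧[_] Ax (Γ₁ ++ Γ₂) S) ×
    _⊆_ Ax (⟦_⟧[_] Ax Γ₂ S) (⟦_⟧[_] Ax (Γ₁ ++ Γ₂) S)
  ⟦⟧-directed S Γ₁ Γ₂ = ⟦⟧-antitone S (++⁻ˡ Γ₁) , ⟦⟧-antitone S (++⁻ʳ Γ₁)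

  ∈⟦singleton⟧ : ∀ (S : Subset Ax) (φ : Form Ax) → ⟦_⟧[_] Ax (φ ∷ []) S φ
  ∈⟦singleton⟧ S φ W W-state φ∈W W⊆S = head φ∈W

  ⟦⟧⊆state : ∀ {S : Subset Ax} {Γ : List (Form Ax)} → IsState Ax S →
    _⊆ₗ_ Ax Γ S → _⊆_ Ax (⟦_⟧[_] Ax Γ S) S
  ⟦⟧⊆state S-state Γ⊆S φ φ∈⟦Γ⟧ = φ∈⟦Γ⟧ _ S-state Γ⊆S (λ _ ψ∈S → ψ∈S)

lemma3p3 : ∀ {P : Set} (Ax : List P → Set) (S : Subset Ax) → IsState Ax S →
    ((Γ₁ Γ₂ : List (Form Ax)) → _⊆ₗ_ Ax Γ₁ S → _⊆ₗ_ Ax Γ₂ S →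
      Σ (List (Form Ax)) λ Γ₃ → _⊆ₗ_ Ax Γ₃ S ×
        _⊆_ Ax (⟦_⟧[_] Ax Γ₁ S) (⟦_⟧[_] Ax Γ₃ S) ×
        _⊆_ Ax (⟦_⟧[_] Ax Γ₂ S) (⟦_⟧[_] Ax Γ₃ S))
    × (∀ (φ : Form Ax) →
        S φ ⇔ Σ (List (Form Ax)) λ Γ → _⊆ₗ_ Ax Γ S × ⟦_⟧[_] Ax Γ S φ)
lemma3p3 Ax S S-state =
  (λ Γ₁ Γ₂ Γ₁⊆S Γ₂⊆S → Γ₁ ++ Γ₂ , ++⁺ Γ₁⊆S Γ₂⊆S , ⟦⟧-directed Ax S Γ₁ Γ₂) ,
  λ φ → mk⇔ (λ φ∈S → φ ∷ [] , φ∈S ∷ [] , ∈⟦singleton⟧ Ax S φ)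
            (λ { (Γ , Γ⊆S , φ∈⟦Γ⟧) → ⟦⟧⊆state Ax S-state Γ⊆S φ φ∈⟦Γ⟧ })
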